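{- Let $\mathcal{L}$ be a first-order signature and $S$ an $\mathcal{L}$-Henkin sequent. If $S'$ is obtained from $S$ by (capture-avoiding) renaming of some bound variables in some of its formulas, then $S$ and $S'$ are interderivable in $\mathcal{ST}^H$, i.e. $S\vdash_{\mathcal{ST}^H}S'$ and $S'\vdash_{\mathcal{ST}^H}S$.
   Context: Signature $\mathcal{L}$: relation and function symbols of finite arity, at least one relation symbol; formulas built with $\neg,\wedge,\vee,\forall,\exists$; $\varphi[x\mapsto t]$ is capture-free substitution. The Henkin expansion $\mathrm{Hen}\,\mathcal{L}=\bigcup_i\mathcal{L}_i$, where $\mathcal{L}_0=\mathcal{L}$ and $\mathcal{L}_{i+1}$ adds to $\mathcal{L}_i$ a new constant $\mathsf{w}(\forall x\,\varphi)$ for each universal $\mathcal{L}_i$-formula $\forall x\,\varphi$ and $\mathsf{w}(\exists x\,\varphi)$ for each existential $\mathcal{L}_i$-formula $\exists x\,\varphi$ (distinct formulas, e.g. alphabetic variants, give distinct constants); its formulas/terms are $\mathcal{L}$-Henkin formulas/terms. An $\mathcal{L}$-Henkin sequent $\Gamma\vartriangleright\Delta$ is a pair of finite sets of $\mathcal{L}$-Henkin formulas; $\varphi,\Gamma$ means $\{\varphi\}\cup\Gamma$. The calculus $\mathcal{ST}^H$ ($t$ ranges over $\mathcal{L}$-Henkin terms): axiom (ID) $\varphi\vartriangleright\varphi$; (WL), (WR) weakening on either side; bidirectional rules, usable top-down and bottom-up (from conclusion to any one premise), premises / conclusion: ($\wedge$L) $\varphi,\psi,\Gamma\vartriangleright\Delta$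 / $\varphi\wedge\psi,\Gamma\vartriangleright\Delta$; ($\wedge$R) $\Gamma\vartriangleright\Delta,\varphi$ and $\Gamma\vartriangleright\Delta,\psi$ / $\Gamma\vartriangleright\Delta,\varphi\wedge\psi$; ($\vee$L) $\varphi,\Gamma\vartriangleright\Delta$ and $\psi,\Gamma\vartriangleright\Delta$ / $\varphi\vee\psi,\Gamma\vartriangleright\Delta$; ($\vee$R) $\Gamma\vartriangleright\Delta,\varphi,\psi$ / $\Gamma\vartriangleright\Delta,\varphi\vee\psi$; ($\neg$R) $\varphi,\Gamma\vartriangleright\Delta$ / $\Gamma\vartriangleright\Delta,\neg\varphi$; ($\neg$L) $\Gamma\vartriangleright\Delta,\varphi$ / $\neg\varphi,\Gamma\vartriangleright\Delta$; ($\forall$LW) $\varphi[x\mapsto\mathsf{w}(\forall x\,\varphi)],\Gamma\vartriangleright\Delta$ / $\forall x\,\varphi,\Gamma\vartriangleright\Delta$; ($\forall$RW) $\Gamma\vartriangleright\Delta,\varphi[x\mapsto\mathsf{w}(\forall x\,\varphi)]$ / $\Gamma\vartriangleright\Delta,\forall x\,\varphi$; ($\exists$LW), ($\exists$RW) analogously with $\mathsf{w}(\exists x\,\varphi)$ and $\exists x\,\varphi$. One-directional rules: (UWI) $\varphi[x\mapsto t],\Gamma\vartriangleright\Delta$ / $\varphi[x\mapsto\mathsf{w}(\forall x\,\varphi)],\Gamma\vartriangleright\Delta$; (EWI) $\Gamma\vartriangleright\Delta,\varphi[x\mapsto t]$ / $\Gamma\vartriangleright\Delta,\varphi[x\mapsto\mathsf{w}(\exists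 x\,\varphi)]$; (EWE) $\varphi[x\mapsto\mathsf{w}(\exists x\,\varphi)],\Gamma\vartriangleright\Delta$ / $\varphi[x\mapsto t],\Gamma\vartriangleright\Delta$; (UWE) $\Gamma\vartriangleright\Delta,\varphi[x\mapsto\mathsf{w}(\forall x\,\varphi)]$ / $\Gamma\vartriangleright\Delta,\varphi[x\mapsto t]$. No cut. $X\vdash_{\mathcal{ST}^H}S$: there is a finite derivation of $S$ whose leaves are (ID) instances or members of $X$. -}

module Defs where

open import Data.Nat using (ℕ; _≟_)
open import Data.Vec using (Vec; []; _∷_)
open import Data.List using (List; []; _∷_)
open import Data.List.Membership.Propositional using (_∈_)
open import Data.Product using (_×_; _,_)
open import Relation.Nullary using (¬_; yes; no)
open import Relation.Binary.PropositionalEquality using (_≡_; _≢_)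

record Signature : Set₁ where
  field
    Rel       : Set
    relArity  : Rel → ℕ
    Fun       : Set
    funArity  : Fun → ℕ
    someRel   : Rel

Var : Set
Var = ℕ

module WithSig (L : Signature) where
  open Signature L

  -- L-Henkin terms and formulas (the union of all L_i of the Henkin expansion).
  -- wU x φ is the Henkin constant w(∀ x φ); wE x φ is w(∃ x φ).
  -- They are constants: atomic, closed, and untouched by substitution/renaming.
  mutual
    data Term : Set where
      var : Var → Term
      fun : (f : Fun) → Vec Term (funArity f) → Term
      wU  : Var → Formula → Term
      wE  : Var → Formula → Term

    data Formula : Set where
      rel : (r : Rel) → Vec Term (relArity r) → Formula
      neg : Formula → Formula
      and : Formula → Formula → Formula
      or  : Formula → Formula → Formula
      all : Var → Formula → Formula
      ex  : Var → Formula → Formula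

  mutual
    substT : Term → Var → Term → Term
    substT (var y) x t with y ≟ x
    ... | yes _ = t
    ... | no  _ = var y
    substT (fun f ts) x t = fun f (substTs ts x t)
    substT (wU y φ) x t = wU y φ
    substT (wE y φ) x t = wE y φ

    substTs : ∀ {n} → Vec Term n → Var → Term → Vec Term n
    substTs []       x t = []
    substTs (s ∷ ss) x t = substT s x t ∷ substTs ss x t

  _[_↦_] : Formula → Var → Term → Formula
  rel r ts [ x ↦ t ] = rel r (substTs ts x t)
  neg φ    [ x ↦ t ] = neg (φ [ x ↦ t ])
  and φ ψ  [ x ↦ t ] = and (φ [ x ↦ t ]) (ψ [ x ↦ t ])
  or φ ψ   [ x ↦ t ] = or (φ [ x ↦ t ]) (ψ [ x ↦ t ])
  all y φ  [ x ↦ t ] with y ≟ x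
  ... | yes _ = all y φ
  ... | no  _ = all y (φ [ x ↦ t ])
  ex y φ   [ x ↦ t ] with y ≟ x
  ... | yes _ = ex y φ
  ... | no  _ = ex y (φ [ x ↦ t ])

  mutual
    data _∈FVT_ (x : Var) : Term → Set where
      here : x ∈FVT var x
      fun  : ∀ {f ts} → x ∈FVTs ts → x ∈FVT fun f ts

    data _∈FVTs_ (x : Var) : ∀ {n} → Vec Term n → Set where
      head : ∀ {n s} {ss : Vec Term n} → x ∈FVT s → x ∈FVTs (s ∷ ss)
      tail : ∀ {n s} {ss : Vec Term n} → x ∈FVTs ss → x ∈FVTs (s ∷ ss)

  data _∈FV_ (x : Var) : Formula → Set where
    rel  : ∀ {r ts} → x ∈FVTs ts → x ∈FV rel r ts
    neg  : ∀ {φ} → x ∈FV φ → x ∈FV neg φ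
    andˡ : ∀ {φ ψ} → x ∈FV φ → x ∈FV and φ ψ
    andʳ : ∀ {φ ψ} → x ∈FV ψ → x ∈FV and φ ψ
    orˡ  : ∀ {φ ψ} → x ∈FV φ → x ∈FV or φ ψ
    orʳ  : ∀ {φ ψ} → x ∈FV ψ → x ∈FV or φ ψ
    all  : ∀ {y φ} → x ≢ y → x ∈FV φ → x ∈FV all y φ
    ex   : ∀ {y φ} → x ≢ y → x ∈FV φ → x ∈FV ex y φ

  data FreeFor (t : Term) (x : Var) : Formula → Set where
    rel    : ∀ {r ts} → FreeFor t x (rel r ts)
    neg    : ∀ {φ} → FreeFor t x φ → FreeFor t x (neg φ)
    and    : ∀ {φ ψ} → FreeFor t x φ → FreeFor t x ψ → FreeFor t x (and φ ψ)
    or     : ∀ {φ ψ} → FreeFor t x φ → FreeFor t x ψ → FreeFor t x (or φ ψ)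
    allVac : ∀ {y φ} → ¬ (x ∈FV all y φ) → FreeFor t x (all y φ)
    all    : ∀ {y φ} → ¬ (y ∈FVT t) → FreeFor t x φ → FreeFor t x (all y φ)
    exVac  : ∀ {y φ} → ¬ (x ∈FV ex y φ) → FreeFor t x (ex y φ)
    ex     : ∀ {y φ} → ¬ (y ∈FVT t) → FreeFor t x φ → FreeFor t x (ex y φ)

  -- Alphabetic variance: the equivalence closure, under all formula
  -- constructors, of capture-avoiding renaming of one bound variable.
  -- (Henkin constants are atomic symbols and are not renamed inside.)
  infix 4 _≈α_
  data _≈α_ : Formula → Formula → Set where
    rel       : ∀ {r ts} → rel r ts ≈α rel r ts
    neg       : ∀ {φ φ'} → φ ≈α φ' → neg φ ≈α neg φ'
    and       : ∀ {φ φ' ψ ψ'} → φ ≈α φ' → ψ ≈α ψ' → and φ ψ ≈α and φ' ψ'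
    or        : ∀ {φ φ' ψ ψ'} → φ ≈α φ' → ψ ≈α ψ' → or φ ψ ≈α or φ' ψ'
    all       : ∀ {x φ φ'} → φ ≈α φ' → all x φ ≈α all x φ'
    ex        : ∀ {x φ φ'} → φ ≈α φ' → ex x φ ≈α ex x φ'
    renameAll : ∀ {x y φ} → ¬ (y ∈FV all x φ) → FreeFor (var y) x φ →
                all x φ ≈α all y (φ [ x ↦ var y ])
    renameEx  : ∀ {x y φ} → ¬ (y ∈FV ex x φ) → FreeFor (var y) x φ →
                ex x φ ≈α ex y (φ [ x ↦ var y ])
    sym       : ∀ {φ ψ} → φ ≈α ψ → ψ ≈α φ
    trans     : ∀ {φ ψ χ} → φ ≈α ψ → ψ ≈α χ → φ ≈α χ

  -- Finite sets of formulas are represented by lists, considered up to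
  -- having the same members.
  SameSet : List Formula → List Formula → Set
  SameSet Γ Γ' = (∀ {φ} → φ ∈ Γ → φ ∈ Γ') × (∀ {φ} → φ ∈ Γ' → φ ∈ Γ)

  Sequent : Set
  Sequent = List Formula × List Formula

  -- Derivability X ⊢ S in ST^H (no cut).  Bidirectional rules have a
  -- top-down constructor (↓) and a bottom-up one (↑) for each premise.
  infix 3 _⊢_
  data _⊢_ (X : Sequent → Set) : Sequent → Set where
    hyp  : ∀ {S} → X S → X ⊢ S
    conv : ∀ {Γ Γ' Δ Δ'} → SameSet Γ Γ' → SameSet Δ Δ' →
           X ⊢ (Γ , Δ) → X ⊢ (Γ' , Δ')
    ID   : ∀ {φ} → X ⊢ (φ ∷ [] , φ ∷ [])
    WL   : ∀ {φ Γ Δ} → X ⊢ (Γ , Δ) → X ⊢ (φ ∷ Γ , Δ)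
    WR   : ∀ {φ Γ Δ} → X ⊢ (Γ , Δ) → X ⊢ (Γ , φ ∷ Δ)
    ∧L↓  : ∀ {φ ψ Γ Δ} → X ⊢ (φ ∷ ψ ∷ Γ , Δ) → X ⊢ (and φ ψ ∷ Γ , Δ)
    ∧L↑  : ∀ {φ ψ Γ Δ} → X ⊢ (and φ ψ ∷ Γ , Δ) → X ⊢ (φ ∷ ψ ∷ Γ , Δ)
    ∧R↓  : ∀ {φ ψ Γ Δ} → X ⊢ (Γ , φ ∷ Δ) → X ⊢ (Γ , ψ ∷ Δ) →
           X ⊢ (Γ , and φ ψ ∷ Δ)
    ∧R↑₁ : ∀ {φ ψ Γ Δ} → X ⊢ (Γ , and φ ψ ∷ Δ) → X ⊢ (Γ , φ ∷ Δ)
    ∧R↑₂ : ∀ {φ ψ Γ Δ} → X ⊢ (Γ , and φ ψ ∷ Δ) → X ⊢ (Γ , ψ ∷ Δ)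
    ∨L↓  : ∀ {φ ψ Γ Δ} → X ⊢ (φ ∷ Γ , Δ) → X ⊢ (ψ ∷ Γ , Δ) →
           X ⊢ (or φ ψ ∷ Γ , Δ)
    ∨L↑₁ : ∀ {φ ψ Γ Δ} → X ⊢ (or φ ψ ∷ Γ , Δ) → X ⊢ (φ ∷ Γ , Δ)
    ∨L↑₂ : ∀ {φ ψ Γ Δ} → X ⊢ (or φ ψ ∷ Γ , Δ) → X ⊢ (ψ ∷ Γ , Δ)
    ∨R↓  : ∀ {φ ψ Γ Δ} → X ⊢ (Γ , φ ∷ ψ ∷ Δ) → X ⊢ (Γ , or φ ψ ∷ Δ)
    ∨R↑  : ∀ {φ ψ Γ Δ} → X ⊢ (Γ , or φ ψ ∷ Δ) → X ⊢ (Γ , φ ∷ ψ ∷ Δ)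
    ¬R↓  : ∀ {φ Γ Δ} → X ⊢ (φ ∷ Γ , Δ) → X ⊢ (Γ , neg φ ∷ Δ)
    ¬R↑  : ∀ {φ Γ Δ} → X ⊢ (Γ , neg φ ∷ Δ) → X ⊢ (φ ∷ Γ , Δ)
    ¬L↓  : ∀ {φ Γ Δ} → X ⊢ (Γ , φ ∷ Δ) → X ⊢ (neg φ ∷ Γ , Δ)
    ¬L↑  : ∀ {φ Γ Δ} → X ⊢ (neg φ ∷ Γ , Δ) → X ⊢ (Γ , φ ∷ Δ)
    ∀LW↓ : ∀ {x φ Γ Δ} → X ⊢ (φ [ x ↦ wU x φ ] ∷ Γ , Δ) → X ⊢ (all x φ ∷ Γ , Δ)
    ∀LW↑ : ∀ {x φ Γ Δ} → X ⊢ (all x φ ∷ Γ , Δ) → X ⊢ (φ [ x ↦ wU x φ ] ∷ Γ , Δ)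
    ∀RW↓ : ∀ {x φ Γ Δ} → X ⊢ (Γ , φ [ x ↦ wU x φ ] ∷ Δ) → X ⊢ (Γ , all x φ ∷ Δ)
    ∀RW↑ : ∀ {x φ Γ Δ} → X ⊢ (Γ , all x φ ∷ Δ) → X ⊢ (Γ , φ [ x ↦ wU x φ ] ∷ Δ)
    ∃LW↓ : ∀ {x φ Γ Δ} → X ⊢ (φ [ x ↦ wE x φ ] ∷ Γ , Δ) → X ⊢ (ex x φ ∷ Γ , Δ)
    ∃LW↑ : ∀ {x φ Γ Δ} → X ⊢ (ex x φ ∷ Γ , Δ) → X ⊢ (φ [ x ↦ wE x φ ] ∷ Γ , Δ)
    ∃RW↓ : ∀ {x φ Γ Δ} → X ⊢ (Γ , φ [ x ↦ wE x φ ] ∷ Δ) → X ⊢ (Γ , ex x φ ∷ Δ)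
    ∃RW↑ : ∀ {x φ Γ Δ} → X ⊢ (Γ , ex x φ ∷ Δ) → X ⊢ (Γ , φ [ x ↦ wE x φ ] ∷ Δ)
    UWI  : ∀ {x φ t Γ Δ} → FreeFor t x φ →
           X ⊢ (φ [ x ↦ t ] ∷ Γ , Δ) → X ⊢ (φ [ x ↦ wU x φ ] ∷ Γ , Δ)
    EWI  : ∀ {x φ t Γ Δ} → FreeFor t x φ →
           X ⊢ (Γ , φ [ x ↦ t ] ∷ Δ) → X ⊢ (Γ , φ [ x ↦ wE x φ ] ∷ Δ)
    EWE  : ∀ {x φ t Γ Δ} → FreeFor t x φ →
           X ⊢ (φ [ x ↦ wE x φ ] ∷ Γ , Δ) → X ⊢ (φ [ x ↦ t ] ∷ Γ , Δ)
    UWE  : ∀ {x φ t Γ Δ} → FreeFor t x φ →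
           X ⊢ (Γ , φ [ x ↦ wU x φ ] ∷ Δ) → X ⊢ (Γ , φ [ x ↦ t ] ∷ Δ)

-- For quantifiers this rests on two facts.  First, α-variants have α-equivalent instances: for every
-- closed term c, φ [ x ↦ c ] ≈α φ' [ x ↦ c ], at smaller depth.  Second, the witness rules UWI/UWE
-- (EWI/EWE) exchange the Henkin constant of ∀x φ for any closed term, in particular for the constant
-- of ∀y φ'.  So ∀LW↑, a transformation of the instance, UWI and ∀LW↓ turn ∀x φ into ∀y φ' on the
-- left, and similarly in the other three cases; the whole argument is an induction on depth.
module Submission where

open import Defs
open import Data.List using (List; []; _∷_; _++_; map)
open import Data.List.Membership.Propositional using (_∈_)
open import Data.List.Relation.Unary.Any using (here; there)
open import Data.List.Relation.Binary.Pointwise using (Pointwise; []; _∷_; symmetric)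
import Data.List.Relation.Binary.Pointwise as Pointwise
open import Data.List.Relation.Binary.Permutation.Propositional using (_↭_; ↭-refl; ↭-sym)
import Data.List.Relation.Binary.Permutation.Propositional as ↭
open import Data.List.Relation.Binary.Permutation.Propositional.Properties
  using (∈-resp-↭; shift; ++-identityʳ)
open import Data.Nat using (ℕ; zero; suc; _≟_; _⊔_; _≤_)
open import Data.Nat.Properties using (m≤m⊔n; m≤n⊔m; ≤-refl; ≤-trans; <⇒≤; ≤-pred)
open import Data.Product using (_×_; _,_; proj₁; proj₂)
open import Data.Vec using (Vec; []; _∷_)
open import Relation.Nullary using (¬_; yes; no; contradiction)
open import Relation.Binary.PropositionalEquality using (_≡_; _≢_; refl; cong; cong₂; subst; ≢-sym)
import Relation.Binary.PropositionalEquality as ≡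
open ≡.≡-Reasoning

pointwise-map : ∀ {a ℓ} {A : Set a} {R : A → A → Set ℓ} (f : A → A) (xs : List A) →
                (∀ {x} → x ∈ xs → R x (f x)) → Pointwise R xs (map f xs)
pointwise-map f []       r = []
pointwise-map f (x ∷ xs) r = r (here refl) ∷ pointwise-map f xs (λ x∈xs → r (there x∈xs))

module AlphaVariants (L : Signature) where
  open WithSig L

  Closed : Term → Set
  Closed t = ∀ {z} → ¬ z ∈FVT t

  wU-closed : ∀ {x φ} → Closed (wU x φ)
  wU-closed ()

  wE-closed : ∀ {x φ} → Closed (wE x φ)
  wE-closed ()

  var-∉FVT : ∀ {u v} → u ≢ v → ¬ u ∈FVT var v
  var-∉FVT u≢v here = u≢v refl

  var-∉FVT⁻ : ∀ {u v} → ¬ u ∈FVT var v → u ≢ v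
  var-∉FVT⁻ u∉v refl = u∉v here

  FreeFor-closed : ∀ {t x} φ → Closed t → FreeFor t x φ
  FreeFor-closed (rel r ts) cl = rel
  FreeFor-closed (neg φ)    cl = neg (FreeFor-closed φ cl)
  FreeFor-closed (and φ ψ)  cl = and (FreeFor-closed φ cl) (FreeFor-closed ψ cl)
  FreeFor-closed (or φ ψ)   cl = or (FreeFor-closed φ cl) (FreeFor-closed ψ cl)
  FreeFor-closed (all y φ)  cl = all cl (FreeFor-closed φ cl)
  FreeFor-closed (ex y φ)   cl = ex cl (FreeFor-closed φ cl)

  var-subst-≡ : ∀ {v x t} → v ≡ x → substT (var v) x t ≡ t
  var-subst-≡ {v} {x} v≡x with v ≟ x
  ... | yes _   = refl
  ... | no v≢x = contradiction v≡x v≢x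

  var-subst-≢ : ∀ {v x t} → v ≢ x → substT (var v) x t ≡ var v
  var-subst-≢ {v} {x} v≢x with v ≟ x
  ... | yes v≡x = contradiction v≡x v≢x
  ... | no _    = refl

  all-subst-≡ : ∀ {w x φ t} → w ≡ x → all w φ [ x ↦ t ] ≡ all w φ
  all-subst-≡ {w} {x} w≡x with w ≟ x
  ... | yes _   = refl
  ... | no w≢x = contradiction w≡x w≢x

  all-subst-≢ : ∀ {w x φ t} → w ≢ x → all w φ [ x ↦ t ] ≡ all w (φ [ x ↦ t ])
  all-subst-≢ {w} {x} w≢x with w ≟ x
  ... | yes w≡x = contradiction w≡x w≢x
  ... | no _    = refl

  ex-subst-≡ : ∀ {w x φ t} → w ≡ x → ex w φ [ x ↦ t ] ≡ ex w φ
  ex-subst-≡ {w} {x} w≡x with w ≟ x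
  ... | yes _   = refl
  ... | no w≢x = contradiction w≡x w≢x

  ex-subst-≢ : ∀ {w x φ t} → w ≢ x → ex w φ [ x ↦ t ] ≡ ex w (φ [ x ↦ t ])
  ex-subst-≢ {w} {x} w≢x with w ≟ x
  ... | yes w≡x = contradiction w≡x w≢x
  ... | no _    = refl

  mutual
    substT-fresh : ∀ {x} s t → ¬ x ∈FVT s → substT s x t ≡ s
    substT-fresh {x} (var y) t x∉s with y ≟ x
    ... | yes refl = contradiction here x∉s
    ... | no _     = refl
    substT-fresh (fun f ts) t x∉s = cong (fun f) (substTs-fresh ts t (λ p → x∉s (fun p)))
    substT-fresh (wU y φ)   t x∉s = refl
    substT-fresh (wE y φ)   t x∉s = refl

    substTs-fresh : ∀ {x n} (ss : Vec Term n) t → ¬ x ∈FVTs ss → substTs ss x t ≡ ss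
    substTs-fresh []       t x∉ss = refl
    substTs-fresh (s ∷ ss) t x∉ss =
      cong₂ _∷_ (substT-fresh s t (λ p → x∉ss (head p)))
                (substTs-fresh ss t (λ p → x∉ss (tail p)))

  subst-fresh : ∀ {x} φ t → ¬ x ∈FV φ → φ [ x ↦ t ] ≡ φ
  subst-fresh (rel r ts) t x∉φ = cong (rel r) (substTs-fresh ts t (λ p → x∉φ (rel p)))
  subst-fresh (neg φ)    t x∉φ = cong neg (subst-fresh φ t (λ p → x∉φ (neg p)))
  subst-fresh (and φ ψ)  t x∉φ =
    cong₂ and (subst-fresh φ t (λ p → x∉φ (andˡ p))) (subst-fresh ψ t (λ p → x∉φ (andʳ p)))
  subst-fresh (or φ ψ)   t x∉φ =
    cong₂ or (subst-fresh φ t (λ p → x∉φ (orˡ p))) (subst-fresh ψ t (λ p → x∉φ (orʳ p)))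
  subst-fresh {x} (all y φ) t x∉φ with y ≟ x
  ... | yes _   = refl
  ... | no y≢x = cong (all y) (subst-fresh φ t (λ p → x∉φ (all (≢-sym y≢x) p)))
  subst-fresh {x} (ex y φ) t x∉φ with y ≟ x
  ... | yes _   = refl
  ... | no y≢x = cong (ex y) (subst-fresh φ t (λ p → x∉φ (ex (≢-sym y≢x) p)))

  mutual
    substT-self : ∀ {x} s → substT s x (var x) ≡ s
    substT-self {x} (var y) with y ≟ x
    ... | yes refl = refl
    ... | no _     = refl
    substT-self (fun f ts) = cong (fun f) (substTs-self ts)
    substT-self (wU y φ)   = refl
    substT-self (wE y φ)   = refl

    substTs-self : ∀ {x n} (ss : Vec Term n) → substTs ss x (var x) ≡ ss
    substTs-self []       = refl
    substTs-self (s ∷ ss) = cong₂ _∷_ (substT-self s) (substTs-self ss)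

  subst-self : ∀ {x} φ → φ [ x ↦ var x ] ≡ φ
  subst-self (rel r ts) = cong (rel r) (substTs-self ts)
  subst-self (neg φ)    = cong neg (subst-self φ)
  subst-self (and φ ψ)  = cong₂ and (subst-self φ) (subst-self ψ)
  subst-self (or φ ψ)   = cong₂ or (subst-self φ) (subst-self ψ)
  subst-self {x} (all y φ) with y ≟ x
  ... | yes _ = refl
  ... | no _  = cong (all y) (subst-self φ)
  subst-self {x} (ex y φ) with y ≟ x
  ... | yes _ = refl
  ... | no _  = cong (ex y) (subst-self φ)

  mutual
    ∉FVT-substT : ∀ {x t} s → ¬ x ∈FVT t → ¬ x ∈FVT substT s x t
    ∉FVT-substT {x} (var y) x∉t with y ≟ x
    ... | yes _   = x∉t
    ... | no y≢x = λ { here → y≢x refl }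
    ∉FVT-substT (fun f ts) x∉t (fun p) = ∉FVTs-substTs ts x∉t p

    ∉FVTs-substTs : ∀ {x t n} (ss : Vec Term n) → ¬ x ∈FVT t → ¬ x ∈FVTs substTs ss x t
    ∉FVTs-substTs (s ∷ ss) x∉t (head p) = ∉FVT-substT s x∉t p
    ∉FVTs-substTs (s ∷ ss) x∉t (tail p) = ∉FVTs-substTs ss x∉t p

  ∉FV-subst : ∀ {x t} φ → ¬ x ∈FVT t → ¬ x ∈FV (φ [ x ↦ t ])
  ∉FV-subst (rel r ts) x∉t (rel p)  = ∉FVTs-substTs ts x∉t p
  ∉FV-subst (neg φ)    x∉t (neg p)  = ∉FV-subst φ x∉t p
  ∉FV-subst (and φ ψ)  x∉t (andˡ p) = ∉FV-subst φ x∉t p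
  ∉FV-subst (and φ ψ)  x∉t (andʳ p) = ∉FV-subst ψ x∉t p
  ∉FV-subst (or φ ψ)   x∉t (orˡ p)  = ∉FV-subst φ x∉t p
  ∉FV-subst (or φ ψ)   x∉t (orʳ p)  = ∉FV-subst ψ x∉t p
  ∉FV-subst {x} (all y φ) x∉t p with y ≟ x | p
  ... | yes refl | all x≢x _ = x≢x refl
  ... | no _     | all _ q   = ∉FV-subst φ x∉t q
  ∉FV-subst {x} (ex y φ) x∉t p with y ≟ x | p
  ... | yes refl | ex x≢x _ = x≢x refl
  ... | no _     | ex _ q   = ∉FV-subst φ x∉t q

  mutual
    ∈FVT-substT-closed⁻ : ∀ {x c z} s → Closed c → z ∈FVT substT s x c → z ∈FVT s
    ∈FVT-substT-closed⁻ {x} (var y) cl p with y ≟ x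
    ... | yes _ = contradiction p cl
    ... | no _  = p
    ∈FVT-substT-closed⁻ (fun f ts) cl (fun p) = fun (∈FVTs-substTs-closed⁻ ts cl p)

    ∈FVTs-substTs-closed⁻ : ∀ {x c z n} (ss : Vec Term n) → Closed c →
                            z ∈FVTs substTs ss x c → z ∈FVTs ss
    ∈FVTs-substTs-closed⁻ (s ∷ ss) cl (head p) = head (∈FVT-substT-closed⁻ s cl p)
    ∈FVTs-substTs-closed⁻ (s ∷ ss) cl (tail p) = tail (∈FVTs-substTs-closed⁻ ss cl p)

  ∈FV-subst-closed⁻ : ∀ {x c z} φ → Closed c → z ∈FV (φ [ x ↦ c ]) → z ∈FV φ
  ∈FV-subst-closed⁻ (rel r ts) cl (rel p)  = rel (∈FVTs-substTs-closed⁻ ts cl p)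
  ∈FV-subst-closed⁻ (neg φ)    cl (neg p)  = neg (∈FV-subst-closed⁻ φ cl p)
  ∈FV-subst-closed⁻ (and φ ψ)  cl (andˡ p) = andˡ (∈FV-subst-closed⁻ φ cl p)
  ∈FV-subst-closed⁻ (and φ ψ)  cl (andʳ p) = andʳ (∈FV-subst-closed⁻ ψ cl p)
  ∈FV-subst-closed⁻ (or φ ψ)   cl (orˡ p)  = orˡ (∈FV-subst-closed⁻ φ cl p)
  ∈FV-subst-closed⁻ (or φ ψ)   cl (orʳ p)  = orʳ (∈FV-subst-closed⁻ ψ cl p)
  ∈FV-subst-closed⁻ {x} (all y φ) cl p with y ≟ x | p
  ... | yes _ | q          = q
  ... | no _  | all y≢z q = all y≢z (∈FV-subst-closed⁻ φ cl q)
  ∈FV-subst-closed⁻ {x} (ex y φ) cl p with y ≟ x | p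
  ... | yes _ | q         = q
  ... | no _  | ex y≢z q = ex y≢z (∈FV-subst-closed⁻ φ cl q)

  FreeFor-subst-closed : ∀ {y z x c} ψ → Closed c → FreeFor (var y) z ψ →
                         FreeFor (var y) z (ψ [ x ↦ c ])
  FreeFor-subst-closed (rel r ts) cl rel       = rel
  FreeFor-subst-closed (neg ψ)    cl (neg f)   = neg (FreeFor-subst-closed ψ cl f)
  FreeFor-subst-closed (and ψ χ)  cl (and f g) =
    and (FreeFor-subst-closed ψ cl f) (FreeFor-subst-closed χ cl g)
  FreeFor-subst-closed (or ψ χ)   cl (or f g)  =
    or (FreeFor-subst-closed ψ cl f) (FreeFor-subst-closed χ cl g)
  FreeFor-subst-closed {x = x} (all w χ) cl ff with w ≟ x | ff
  ... | yes _ | _           = ff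
  ... | no _  | allVac z∉  = allVac (λ { (all ne p) → z∉ (all ne (∈FV-subst-closed⁻ χ cl p)) })
  ... | no _  | all w∉y f = all w∉y (FreeFor-subst-closed χ cl f)
  FreeFor-subst-closed {x = x} (ex w χ) cl ff with w ≟ x | ff
  ... | yes _ | _          = ff
  ... | no _  | exVac z∉  = exVac (λ { (ex ne p) → z∉ (ex ne (∈FV-subst-closed⁻ χ cl p)) })
  ... | no _  | ex w∉y f = ex w∉y (FreeFor-subst-closed χ cl f)

  module QuantifierStep (Q : Var → Formula → Formula)
    (Q-subst-≡ : ∀ {w x φ t} → w ≡ x → Q w φ [ x ↦ t ] ≡ Q w φ)
    (Q-subst-≢ : ∀ {w x φ t} → w ≢ x → Q w φ [ x ↦ t ] ≡ Q w (φ [ x ↦ t ])) where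

    subst-comm-step : ∀ {x z s t w χ} → x ≢ z →
      (χ [ z ↦ s ]) [ x ↦ t ] ≡ (χ [ x ↦ t ]) [ z ↦ s ] →
      (Q w χ [ z ↦ s ]) [ x ↦ t ] ≡ (Q w χ [ x ↦ t ]) [ z ↦ s ]
    subst-comm-step {x} {z} {s} {t} {w} {χ} x≢z ih with w ≟ z | w ≟ x
    ... | yes w≡z | yes w≡x = contradiction (≡.trans (≡.sym w≡x) w≡z) x≢z
    ... | yes w≡z | no w≢x = begin
      (Q w χ [ z ↦ s ]) [ x ↦ t ]  ≡⟨ cong (_[ x ↦ t ]) (Q-subst-≡ w≡z) ⟩
      Q w χ [ x ↦ t ]              ≡⟨ Q-subst-≢ w≢x ⟩
      Q w (χ [ x ↦ t ])            ≡⟨ Q-subst-≡ w≡z ⟨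
      Q w (χ [ x ↦ t ]) [ z ↦ s ]  ≡⟨ cong (_[ z ↦ s ]) (Q-subst-≢ w≢x) ⟨
      (Q w χ [ x ↦ t ]) [ z ↦ s ]  ∎
    ... | no w≢z | yes w≡x = begin
      (Q w χ [ z ↦ s ]) [ x ↦ t ]  ≡⟨ cong (_[ x ↦ t ]) (Q-subst-≢ w≢z) ⟩
      Q w (χ [ z ↦ s ]) [ x ↦ t ]  ≡⟨ Q-subst-≡ w≡x ⟩
      Q w (χ [ z ↦ s ])            ≡⟨ Q-subst-≢ w≢z ⟨
      Q w χ [ z ↦ s ]              ≡⟨ cong (_[ z ↦ s ]) (Q-subst-≡ w≡x) ⟨
      (Q w χ [ x ↦ t ]) [ z ↦ s ]  ∎
    ... | no w≢z | no w≢x = begin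
      (Q w χ [ z ↦ s ]) [ x ↦ t ]      ≡⟨ cong (_[ x ↦ t ]) (Q-subst-≢ w≢z) ⟩
      Q w (χ [ z ↦ s ]) [ x ↦ t ]      ≡⟨ Q-subst-≢ w≢x ⟩
      Q w ((χ [ z ↦ s ]) [ x ↦ t ])    ≡⟨ cong (Q w) ih ⟩
      Q w ((χ [ x ↦ t ]) [ z ↦ s ])    ≡⟨ Q-subst-≢ w≢z ⟨
      Q w (χ [ x ↦ t ]) [ z ↦ s ]      ≡⟨ cong (_[ z ↦ s ]) (Q-subst-≢ w≢x) ⟨
      (Q w χ [ x ↦ t ]) [ z ↦ s ]      ∎

    rename-subst-step : ∀ {x y c w χ} → w ≢ y → Q w χ [ y ↦ c ] ≡ Q w χ →
      (χ [ x ↦ var y ]) [ y ↦ c ] ≡ χ [ x ↦ c ] →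
      (Q w χ [ x ↦ var y ]) [ y ↦ c ] ≡ Q w χ [ x ↦ c ]
    rename-subst-step {x} {y} {c} {w} {χ} w≢y y-fresh ih with w ≟ x
    ... | yes w≡x = begin
      (Q w χ [ x ↦ var y ]) [ y ↦ c ]  ≡⟨ cong (_[ y ↦ c ]) (Q-subst-≡ w≡x) ⟩
      Q w χ [ y ↦ c ]                  ≡⟨ y-fresh ⟩
      Q w χ                            ≡⟨ Q-subst-≡ w≡x ⟨
      Q w χ [ x ↦ c ]                  ∎
    ... | no w≢x = begin
      (Q w χ [ x ↦ var y ]) [ y ↦ c ]  ≡⟨ cong (_[ y ↦ c ]) (Q-subst-≢ w≢x) ⟩
      Q w (χ [ x ↦ var y ]) [ y ↦ c ]  ≡⟨ Q-subst-≢ w≢y ⟩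
      Q w ((χ [ x ↦ var y ]) [ y ↦ c ]) ≡⟨ cong (Q w) ih ⟩
      Q w (χ [ x ↦ c ])                ≡⟨ Q-subst-≢ w≢x ⟨
      Q w χ [ x ↦ c ]                  ∎

  module AllStep = QuantifierStep all all-subst-≡ all-subst-≢
  module ExStep  = QuantifierStep ex  ex-subst-≡  ex-subst-≢

  mutual
    substT-comm : ∀ {x z s t} → x ≢ z → ¬ x ∈FVT s → ¬ z ∈FVT t → ∀ r →
                  substT (substT r z s) x t ≡ substT (substT r x t) z s
    substT-comm {x} {z} {s} {t} x≢z x∉s z∉t (var v) with v ≟ z | v ≟ x
    ... | yes v≡z | yes v≡x = contradiction (≡.trans (≡.sym v≡x) v≡z) x≢z
    ... | yes v≡z | no v≢x = begin
      substT s x t              ≡⟨ substT-fresh s t x∉s ⟩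
      s                         ≡⟨ var-subst-≡ v≡z ⟨
      substT (var v) z s        ∎
    ... | no v≢z | yes v≡x = begin
      substT (var v) x t        ≡⟨ var-subst-≡ v≡x ⟩
      t                         ≡⟨ substT-fresh t s z∉t ⟨
      substT t z s              ∎
    ... | no v≢z | no v≢x = begin
      substT (var v) x t        ≡⟨ var-subst-≢ v≢x ⟩
      var v                     ≡⟨ var-subst-≢ v≢z ⟨
      substT (var v) z s        ∎
    substT-comm x≢z x∉s z∉t (fun f ts) = cong (fun f) (substTs-comm x≢z x∉s z∉t ts)
    substT-comm x≢z x∉s z∉t (wU _ _)   = refl
    substT-comm x≢z x∉s z∉t (wE _ _)   = refl

    substTs-comm : ∀ {x z s t n} → x ≢ z → ¬ x ∈FVT s → ¬ z ∈FVT t → (rs : Vec Term n) →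
                   substTs (substTs rs z s) x t ≡ substTs (substTs rs x t) z s
    substTs-comm x≢z x∉s z∉t []       = refl
    substTs-comm x≢z x∉s z∉t (r ∷ rs) =
      cong₂ _∷_ (substT-comm x≢z x∉s z∉t r) (substTs-comm x≢z x∉s z∉t rs)

  subst-comm : ∀ {x z s t} → x ≢ z → ¬ x ∈FVT s → ¬ z ∈FVT t → ∀ ψ →
               (ψ [ z ↦ s ]) [ x ↦ t ] ≡ (ψ [ x ↦ t ]) [ z ↦ s ]
  subst-comm x≢z x∉s z∉t (rel r ts) = cong (rel r) (substTs-comm x≢z x∉s z∉t ts)
  subst-comm x≢z x∉s z∉t (neg ψ)    = cong neg (subst-comm x≢z x∉s z∉t ψ)
  subst-comm x≢z x∉s z∉t (and ψ χ)  =
    cong₂ and (subst-comm x≢z x∉s z∉t ψ) (subst-comm x≢z x∉s z∉t χ)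
  subst-comm x≢z x∉s z∉t (or ψ χ)   =
    cong₂ or (subst-comm x≢z x∉s z∉t ψ) (subst-comm x≢z x∉s z∉t χ)
  subst-comm x≢z x∉s z∉t (all w χ)  = AllStep.subst-comm-step {w = w} x≢z (subst-comm x≢z x∉s z∉t χ)
  subst-comm x≢z x∉s z∉t (ex w χ)   = ExStep.subst-comm-step {w = w} x≢z (subst-comm x≢z x∉s z∉t χ)

  mutual
    substT-rename : ∀ {x y c} → y ≢ x → ∀ s → ¬ y ∈FVT s →
                    substT (substT s x (var y)) y c ≡ substT s x c
    substT-rename {x} {y} {c} y≢x (var v) y∉s with v ≟ x
    ... | yes _ = var-subst-≡ refl
    ... | no _  = var-subst-≢ (≢-sym (var-∉FVT⁻ y∉s))
    substT-rename y≢x (fun f ts) y∉s = cong (fun f) (substTs-rename y≢x ts (λ p → y∉s (fun p)))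
    substT-rename y≢x (wU _ _)   y∉s = refl
    substT-rename y≢x (wE _ _)   y∉s = refl

    substTs-rename : ∀ {x y c n} → y ≢ x → (ss : Vec Term n) → ¬ y ∈FVTs ss →
                     substTs (substTs ss x (var y)) y c ≡ substTs ss x c
    substTs-rename y≢x []       y∉ss = refl
    substTs-rename y≢x (s ∷ ss) y∉ss =
      cong₂ _∷_ (substT-rename y≢x s (λ p → y∉ss (head p)))
                (substTs-rename y≢x ss (λ p → y∉ss (tail p)))

  subst-rename-vacuous : ∀ {x y c} φ → ¬ x ∈FV φ → ¬ y ∈FV φ →
                         (φ [ x ↦ var y ]) [ y ↦ c ] ≡ φ [ x ↦ c ]
  subst-rename-vacuous {x} {y} {c} φ x∉φ y∉φ = begin
    (φ [ x ↦ var y ]) [ y ↦ c ]  ≡⟨ cong (_[ y ↦ c ]) (subst-fresh φ (var y) x∉φ) ⟩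
    φ [ y ↦ c ]                  ≡⟨ subst-fresh φ c y∉φ ⟩
    φ                            ≡⟨ subst-fresh φ c x∉φ ⟨
    φ [ x ↦ c ]                  ∎

  subst-rename-distinct : ∀ {x y c} → y ≢ x → ∀ φ → ¬ y ∈FV φ → FreeFor (var y) x φ →
                          (φ [ x ↦ var y ]) [ y ↦ c ] ≡ φ [ x ↦ c ]
  subst-rename-distinct y≢x (rel r ts) y∉ rel = cong (rel r) (substTs-rename y≢x ts (λ p → y∉ (rel p)))
  subst-rename-distinct y≢x (neg φ) y∉ (neg f) =
    cong neg (subst-rename-distinct y≢x φ (λ p → y∉ (neg p)) f)
  subst-rename-distinct y≢x (and φ ψ) y∉ (and f g) =
    cong₂ and (subst-rename-distinct y≢x φ (λ p → y∉ (andˡ p)) f)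
              (subst-rename-distinct y≢x ψ (λ p → y∉ (andʳ p)) g)
  subst-rename-distinct y≢x (or φ ψ) y∉ (or f g) =
    cong₂ or (subst-rename-distinct y≢x φ (λ p → y∉ (orˡ p)) f)
             (subst-rename-distinct y≢x ψ (λ p → y∉ (orʳ p)) g)
  subst-rename-distinct y≢x φ@(all w χ) y∉ (allVac x∉) = subst-rename-vacuous φ x∉ y∉
  subst-rename-distinct {c = c} y≢x φ@(all w χ) y∉ (all w∉y f) =
    AllStep.rename-subst-step (var-∉FVT⁻ w∉y) (subst-fresh φ c y∉)
      (subst-rename-distinct y≢x χ (λ p → y∉ (all (≢-sym (var-∉FVT⁻ w∉y)) p)) f)
  subst-rename-distinct y≢x φ@(ex w χ) y∉ (exVac x∉) = subst-rename-vacuous φ x∉ y∉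
  subst-rename-distinct {c = c} y≢x φ@(ex w χ) y∉ (ex w∉y f) =
    ExStep.rename-subst-step (var-∉FVT⁻ w∉y) (subst-fresh φ c y∉)
      (subst-rename-distinct y≢x χ (λ p → y∉ (ex (≢-sym (var-∉FVT⁻ w∉y)) p)) f)

  subst-rename : ∀ {x y c} φ → (y ≢ x → ¬ y ∈FV φ) → FreeFor (var y) x φ →
                 (φ [ x ↦ var y ]) [ y ↦ c ] ≡ φ [ x ↦ c ]
  subst-rename {x} {y} {c} φ y∉ ff with y ≟ x
  ... | yes refl = cong (_[ y ↦ c ]) (subst-self φ)
  ... | no y≢x  = subst-rename-distinct y≢x φ (y∉ y≢x) ff

  ≈α-cast : ∀ {φ φ' ψ ψ'} → φ ≡ φ' → ψ ≡ ψ' → φ' ≈α ψ' → φ ≈α ψ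
  ≈α-cast refl refl p = p

  ≈α-subst-closed : ∀ {φ φ' x c} → Closed c → φ ≈α φ' → φ [ x ↦ c ] ≈α φ' [ x ↦ c ]
  ≈α-subst-closed cl rel       = rel
  ≈α-subst-closed cl (neg p)   = neg (≈α-subst-closed cl p)
  ≈α-subst-closed cl (and p q) = and (≈α-subst-closed cl p) (≈α-subst-closed cl q)
  ≈α-subst-closed cl (or p q)  = or (≈α-subst-closed cl p) (≈α-subst-closed cl q)
  ≈α-subst-closed {x = x} cl (all {w} p) with w ≟ x
  ... | yes _ = all p
  ... | no _  = all (≈α-subst-closed cl p)
  ≈α-subst-closed {x = x} cl (ex {w} p) with w ≟ x
  ... | yes _ = ex p
  ... | no _  = ex (≈α-subst-closed cl p)
  ≈α-subst-closed {x = x} {c} cl r@(renameAll {z} {y} {ψ} y∉ ff) with z ≟ x | y ≟ x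
  ... | yes _    | yes _   = r
  ... | yes refl | no y≢x = ≈α-cast refl
    (cong (all y) (subst-fresh (ψ [ x ↦ var y ]) c (∉FV-subst ψ (var-∉FVT (≢-sym y≢x)))))
    r
  ... | no z≢x   | yes refl =
    ≈α-cast (cong (all z) (subst-fresh ψ c (λ p → y∉ (all (≢-sym z≢x) p)))) refl r
  ... | no z≢x   | no y≢x =
    ≈α-cast refl (cong (all y) (subst-comm (≢-sym z≢x) (var-∉FVT (≢-sym y≢x)) cl ψ))
      (renameAll (λ { (all y≢z p) → y∉ (all y≢z (∈FV-subst-closed⁻ ψ cl p)) })
                 (FreeFor-subst-closed ψ cl ff))
  ≈α-subst-closed {x = x} {c} cl r@(renameEx {z} {y} {ψ} y∉ ff) with z ≟ x | y ≟ x
  ... | yes _    | yes _   = r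
  ... | yes refl | no y≢x = ≈α-cast refl
    (cong (ex y) (subst-fresh (ψ [ x ↦ var y ]) c (∉FV-subst ψ (var-∉FVT (≢-sym y≢x)))))
    r
  ... | no z≢x   | yes refl =
    ≈α-cast (cong (ex z) (subst-fresh ψ c (λ p → y∉ (ex (≢-sym z≢x) p)))) refl r
  ... | no z≢x   | no y≢x =
    ≈α-cast refl (cong (ex y) (subst-comm (≢-sym z≢x) (var-∉FVT (≢-sym y≢x)) cl ψ))
      (renameEx (λ { (ex y≢z p) → y∉ (ex y≢z (∈FV-subst-closed⁻ ψ cl p)) })
                (FreeFor-subst-closed ψ cl ff))
  ≈α-subst-closed cl (sym p)     = sym (≈α-subst-closed cl p)
  ≈α-subst-closed cl (trans p q) = trans (≈α-subst-closed cl p) (≈α-subst-closed cl q)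

  depth : Formula → ℕ
  depth (rel r ts) = zero
  depth (neg φ)    = suc (depth φ)
  depth (and φ ψ)  = suc (depth φ ⊔ depth ψ)
  depth (or φ ψ)   = suc (depth φ ⊔ depth ψ)
  depth (all x φ)  = suc (depth φ)
  depth (ex x φ)   = suc (depth φ)

  depth-subst : ∀ φ {x t} → depth (φ [ x ↦ t ]) ≡ depth φ
  depth-subst (rel r ts) = refl
  depth-subst (neg φ)    = cong suc (depth-subst φ)
  depth-subst (and φ ψ)  = cong₂ (λ a b → suc (a ⊔ b)) (depth-subst φ) (depth-subst ψ)
  depth-subst (or φ ψ)   = cong₂ (λ a b → suc (a ⊔ b)) (depth-subst φ) (depth-subst ψ)
  depth-subst (all w φ) {x} with w ≟ x
  ... | yes _ = refl
  ... | no _  = cong suc (depth-subst φ)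
  depth-subst (ex w φ) {x} with w ≟ x
  ... | yes _ = refl
  ... | no _  = cong suc (depth-subst φ)

  depth-≈α : ∀ {φ ψ} → φ ≈α ψ → depth φ ≡ depth ψ
  depth-≈α rel       = refl
  depth-≈α (neg p)   = cong suc (depth-≈α p)
  depth-≈α (and p q) = cong₂ (λ a b → suc (a ⊔ b)) (depth-≈α p) (depth-≈α q)
  depth-≈α (or p q)  = cong₂ (λ a b → suc (a ⊔ b)) (depth-≈α p) (depth-≈α q)
  depth-≈α (all p)   = cong suc (depth-≈α p)
  depth-≈α (ex p)    = cong suc (depth-≈α p)
  depth-≈α (renameAll {φ = φ} _ _) = cong suc (≡.sym (depth-subst φ))
  depth-≈α (renameEx {φ = φ} _ _)  = cong suc (≡.sym (depth-subst φ))
  depth-≈α (sym p)     = ≡.sym (depth-≈α p)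
  depth-≈α (trans p q) = ≡.trans (depth-≈α p) (depth-≈α q)

  ↭⇒SameSet : ∀ {Γ Γ'} → Γ ↭ Γ' → SameSet Γ Γ'
  ↭⇒SameSet p = ∈-resp-↭ p , ∈-resp-↭ (↭-sym p)

  permuteˡ : ∀ {X Γ Γ' Δ} → Γ ↭ Γ' → X ⊢ (Γ , Δ) → X ⊢ (Γ' , Δ)
  permuteˡ p = conv (↭⇒SameSet p) (↭⇒SameSet ↭-refl)

  permuteʳ : ∀ {X Γ Δ Δ'} → Δ ↭ Δ' → X ⊢ (Γ , Δ) → X ⊢ (Γ , Δ')
  permuteʳ p = conv (↭⇒SameSet ↭-refl) (↭⇒SameSet p)

  exchangeˡ : ∀ {X φ ψ Γ Δ} → X ⊢ (φ ∷ ψ ∷ Γ , Δ) → X ⊢ (ψ ∷ φ ∷ Γ , Δ)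
  exchangeˡ = permuteˡ (↭.swap _ _ ↭-refl)

  exchangeʳ : ∀ {X φ ψ Γ Δ} → X ⊢ (Γ , φ ∷ ψ ∷ Δ) → X ⊢ (Γ , ψ ∷ φ ∷ Δ)
  exchangeʳ = permuteʳ (↭.swap _ _ ↭-refl)

  infix 4 _⇒ˡ_ _⇒ʳ_ _⇛_

  _⇒ˡ_ : Formula → Formula → Set₁
  φ ⇒ˡ ψ = ∀ {X Γ Δ} → X ⊢ (φ ∷ Γ , Δ) → X ⊢ (ψ ∷ Γ , Δ)

  _⇒ʳ_ : Formula → Formula → Set₁
  φ ⇒ʳ ψ = ∀ {X Γ Δ} → X ⊢ (Γ , φ ∷ Δ) → X ⊢ (Γ , ψ ∷ Δ)

  _⇛_ : Formula → Formula → Set₁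
  φ ⇛ ψ = φ ⇒ˡ ψ × φ ⇒ʳ ψ

  ⇛-refl : ∀ {φ} → φ ⇛ φ
  ⇛-refl = (λ d → d) , (λ d → d)

  ⇛-reflexive : ∀ {φ ψ} → φ ≡ ψ → φ ⇛ ψ
  ⇛-reflexive refl = ⇛-refl

  ⇛-trans : ∀ {φ ψ χ} → φ ⇛ ψ → ψ ⇛ χ → φ ⇛ χ
  ⇛-trans (l , r) (l' , r') = (λ d → l' (l d)) , (λ d → r' (r d))

  ⇛-neg : ∀ {φ ψ} → φ ⇛ ψ → neg φ ⇛ neg ψ
  ⇛-neg (l , r) = (λ d → ¬L↓ (r (¬L↑ d))) , (λ d → ¬R↓ (l (¬R↑ d)))

  ⇛-and : ∀ {φ φ' ψ ψ'} → φ ⇛ φ' → ψ ⇛ ψ' → and φ ψ ⇛ and φ' ψ'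
  ⇛-and (lφ , rφ) (lψ , rψ) =
    (λ d → ∧L↓ (exchangeˡ (lψ (exchangeˡ (lφ (∧L↑ d)))))) ,
    (λ d → ∧R↓ (rφ (∧R↑₁ d)) (rψ (∧R↑₂ d)))

  ⇛-or : ∀ {φ φ' ψ ψ'} → φ ⇛ φ' → ψ ⇛ ψ' → or φ ψ ⇛ or φ' ψ'
  ⇛-or (lφ , rφ) (lψ , rψ) =
    (λ d → ∨L↓ (lφ (∨L↑₁ d)) (lψ (∨L↑₂ d))) ,
    (λ d → ∨R↓ (exchangeʳ (rψ (exchangeʳ (rφ (∨R↑ d))))))

  ⇛-all : ∀ {x φ y ψ} → (∀ c → Closed c → φ [ x ↦ c ] ⇛ ψ [ y ↦ c ]) → all x φ ⇛ all y ψ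
  ⇛-all {x} {φ} {y} {ψ} inst =
    (λ d → ∀LW↓ (UWI (FreeFor-closed ψ wU-closed) (proj₁ (inst (wU x φ) wU-closed) (∀LW↑ d)))) ,
    (λ d → ∀RW↓ (proj₂ (inst (wU y ψ) wU-closed) (UWE (FreeFor-closed φ wU-closed) (∀RW↑ d))))

  ⇛-ex : ∀ {x φ y ψ} → (∀ c → Closed c → φ [ x ↦ c ] ⇛ ψ [ y ↦ c ]) → ex x φ ⇛ ex y ψ
  ⇛-ex {x} {φ} {y} {ψ} inst =
    (λ d → ∃LW↓ (proj₁ (inst (wE y ψ) wE-closed) (EWE (FreeFor-closed φ wE-closed) (∃LW↑ d)))) ,
    (λ d → ∃RW↓ (EWI (FreeFor-closed ψ wE-closed) (proj₂ (inst (wE x φ) wE-closed) (∃RW↑ d))))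

  -- The induction is on depth rather than on the derivation of φ ≈α ψ, because the quantifier
  -- cases apply it to the derivation produced by ≈α-subst-closed.
  ≈α⇒⇛-bounded : ∀ n {φ ψ} → depth φ ≤ n → φ ≈α ψ → φ ⇛ ψ × ψ ⇛ φ
  ≈α⇒⇛-bounded n d≤n rel = ⇛-refl , ⇛-refl
  ≈α⇒⇛-bounded n d≤n (neg p) with ≈α⇒⇛-bounded n (<⇒≤ d≤n) p
  ... | φ⇛φ' , φ'⇛φ = ⇛-neg φ⇛φ' , ⇛-neg φ'⇛φ
  ≈α⇒⇛-bounded n d≤n (and p q)
    with ≈α⇒⇛-bounded n (≤-trans (m≤m⊔n _ _) (<⇒≤ d≤n)) p
       | ≈α⇒⇛-bounded n (≤-trans (m≤n⊔m _ _) (<⇒≤ d≤n)) q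
  ... | φ⇛φ' , φ'⇛φ | ψ⇛ψ' , ψ'⇛ψ = ⇛-and φ⇛φ' ψ⇛ψ' , ⇛-and φ'⇛φ ψ'⇛ψ
  ≈α⇒⇛-bounded n d≤n (or p q)
    with ≈α⇒⇛-bounded n (≤-trans (m≤m⊔n _ _) (<⇒≤ d≤n)) p
       | ≈α⇒⇛-bounded n (≤-trans (m≤n⊔m _ _) (<⇒≤ d≤n)) q
  ... | φ⇛φ' , φ'⇛φ | ψ⇛ψ' , ψ'⇛ψ = ⇛-or φ⇛φ' ψ⇛ψ' , ⇛-or φ'⇛φ ψ'⇛ψ
  ≈α⇒⇛-bounded (suc m) d≤n (all {x} {φ} {φ'} p) =
    ⇛-all (λ c cl → proj₁ (instances c cl)) , ⇛-all (λ c cl → proj₂ (instances c cl))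
    where
    instances : ∀ c → Closed c → φ [ x ↦ c ] ⇛ φ' [ x ↦ c ] × φ' [ x ↦ c ] ⇛ φ [ x ↦ c ]
    instances c cl = ≈α⇒⇛-bounded m (subst (_≤ m) (≡.sym (depth-subst φ)) (≤-pred d≤n))
                       (≈α-subst-closed cl p)
  ≈α⇒⇛-bounded (suc m) d≤n (ex {x} {φ} {φ'} p) =
    ⇛-ex (λ c cl → proj₁ (instances c cl)) , ⇛-ex (λ c cl → proj₂ (instances c cl))
    where
    instances : ∀ c → Closed c → φ [ x ↦ c ] ⇛ φ' [ x ↦ c ] × φ' [ x ↦ c ] ⇛ φ [ x ↦ c ]
    instances c cl = ≈α⇒⇛-bounded m (subst (_≤ m) (≡.sym (depth-subst φ)) (≤-pred d≤n))
                       (≈α-subst-closed cl p)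
  ≈α⇒⇛-bounded n d≤n (renameAll {φ = φ} y∉ ff) =
    ⇛-all (λ c cl → ⇛-reflexive (≡.sym (subst-rename φ (λ y≢x p → y∉ (all y≢x p)) ff))) ,
    ⇛-all (λ c cl → ⇛-reflexive (subst-rename φ (λ y≢x p → y∉ (all y≢x p)) ff))
  ≈α⇒⇛-bounded n d≤n (renameEx {φ = φ} y∉ ff) =
    ⇛-ex (λ c cl → ⇛-reflexive (≡.sym (subst-rename φ (λ y≢x p → y∉ (ex y≢x p)) ff))) ,
    ⇛-ex (λ c cl → ⇛-reflexive (subst-rename φ (λ y≢x p → y∉ (ex y≢x p)) ff))
  ≈α⇒⇛-bounded n d≤n (sym p) with ≈α⇒⇛-bounded n (subst (_≤ n) (≡.sym (depth-≈α p)) d≤n) p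
  ... | ψ⇛φ , φ⇛ψ = φ⇛ψ , ψ⇛φ
  ≈α⇒⇛-bounded n d≤n (trans p q)
    with ≈α⇒⇛-bounded n d≤n p | ≈α⇒⇛-bounded n (subst (_≤ n) (depth-≈α p) d≤n) q
  ... | φ⇛ψ , ψ⇛φ | ψ⇛χ , χ⇛ψ = ⇛-trans φ⇛ψ ψ⇛χ , ⇛-trans χ⇛ψ ψ⇛φ

  ≈α⇒⇛ : ∀ {φ ψ} → φ ≈α ψ → φ ⇛ ψ
  ≈α⇒⇛ {φ} p = proj₁ (≈α⇒⇛-bounded (depth φ) ≤-refl p)

  ≈α⇒⇒ˡ : ∀ {φ ψ} → φ ≈α ψ → φ ⇒ˡ ψ
  ≈α⇒⇒ˡ p = proj₁ (≈α⇒⇛ p)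

  ≈α⇒⇒ʳ : ∀ {φ ψ} → φ ≈α ψ → φ ⇒ʳ ψ
  ≈α⇒⇒ʳ p = proj₂ (≈α⇒⇛ p)

  replaceˡ-++ : ∀ {X Γ Γ' Θ Δ} → Pointwise _⇒ˡ_ Γ Γ' → X ⊢ (Γ ++ Θ , Δ) → X ⊢ (Γ' ++ Θ , Δ)
  replaceˡ-++ [] d = d
  replaceˡ-++ {Γ = φ ∷ Γ} {ψ ∷ Γ'} {Θ} (φ⇒ψ ∷ Γ⇒Γ') d =
    permuteˡ (shift ψ Γ' Θ) (replaceˡ-++ {Θ = ψ ∷ Θ} Γ⇒Γ' (permuteˡ (↭-sym (shift ψ Γ Θ)) (φ⇒ψ d)))

  replaceʳ-++ : ∀ {X Γ Δ Δ' Θ} → Pointwise _⇒ʳ_ Δ Δ' → X ⊢ (Γ , Δ ++ Θ) → X ⊢ (Γ , Δ' ++ Θ)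
  replaceʳ-++ [] d = d
  replaceʳ-++ {Δ = φ ∷ Δ} {ψ ∷ Δ'} {Θ} (φ⇒ψ ∷ Δ⇒Δ') d =
    permuteʳ (shift ψ Δ' Θ) (replaceʳ-++ {Θ = ψ ∷ Θ} Δ⇒Δ' (permuteʳ (↭-sym (shift ψ Δ Θ)) (φ⇒ψ d)))

  replaceˡ : ∀ {X Γ Γ' Δ} → Pointwise _⇒ˡ_ Γ Γ' → X ⊢ (Γ , Δ) → X ⊢ (Γ' , Δ)
  replaceˡ {Γ = Γ} {Γ'} Γ⇒Γ' d =
    permuteˡ (++-identityʳ Γ') (replaceˡ-++ Γ⇒Γ' (permuteˡ (↭-sym (++-identityʳ Γ)) d))

  replaceʳ : ∀ {X Γ Δ Δ'} → Pointwise _⇒ʳ_ Δ Δ' → X ⊢ (Γ , Δ) → X ⊢ (Γ , Δ')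
  replaceʳ {Δ = Δ} {Δ'} Δ⇒Δ' d =
    permuteʳ (++-identityʳ Δ') (replaceʳ-++ Δ⇒Δ' (permuteʳ (↭-sym (++-identityʳ Δ)) d))

  ⊢-resp-≈α : ∀ {X Γ Γ' Δ Δ'} → Pointwise _≈α_ Γ Γ' → Pointwise _≈α_ Δ Δ' →
              X ⊢ (Γ , Δ) → X ⊢ (Γ' , Δ')
  ⊢-resp-≈α Γ≈Γ' Δ≈Δ' d =
    replaceʳ (Pointwise.map ≈α⇒⇒ʳ Δ≈Δ') (replaceˡ (Pointwise.map ≈α⇒⇒ˡ Γ≈Γ') d)

open WithSig

mainTheorem7 : (L : Signature) (Γ Δ : List (Formula L))
    (f g : Formula L → Formula L) →
    (∀ {φ} → φ ∈ Γ → _≈α_ L (f φ) φ) →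
    (∀ {φ} → φ ∈ Δ → _≈α_ L (g φ) φ) →
    (_⊢_ L (λ T → T ≡ (Γ , Δ)) (map f Γ , map g Δ))
    × (_⊢_ L (λ T → T ≡ (map f Γ , map g Δ)) (Γ , Δ))
mainTheorem7 L Γ Δ f g fΓ≈Γ gΔ≈Δ =
  ⊢-resp-≈α Γ≈fΓ Δ≈gΔ (hyp refl) ,
  ⊢-resp-≈α (symmetric (sym) Γ≈fΓ) (symmetric (sym) Δ≈gΔ) (hyp refl)
  where
  open AlphaVariants L
  Γ≈fΓ : Pointwise (_≈α_ L) Γ (map f Γ)
  Γ≈fΓ = pointwise-map f Γ (λ φ∈Γ → sym (fΓ≈Γ φ∈Γ))
  Δ≈gΔ : Pointwise (_≈α_ L) Δ (map g Δ)
  Δ≈gΔ = pointwise-map g Δ (λ φ∈Δ → sym (gΔ≈Δ φ∈Δ))
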